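{- Let $V,U\in\Sigma_\$^+$ with $\mathrm{rot}^1(V)\prec_\omega\mathrm{rot}^1(U)$, and let $e=\mathrm{lcpcount}(\mathrm{rot}^1(V),\mathrm{rot}^1(U))$. Then $\mathrm{lcpcount}(V,U)=0$ if $\pi(V)=\$$ or $\pi(U)=\$$; $\mathrm{lcpcount}(V,U)=e-\pi(V)+1$ if $V\prec_\omega U$ and $\$\neq\pi(V)=\pi(U)<e$; and $\mathrm{lcpcount}(V,U)=1$ otherwise.
   Context: $\Sigma=[0..\sigma]$ integer alphabet, $\$\notin\Sigma$ smaller than every integer, $\Sigma_\$=\Sigma\cup\{\$\}$, $\infty$ larger than every integer. Strings 1-indexed; $X[..i]=X[1..i]$, $X[i..]=X[i..|X|]$; $X^\omega$ infinite concatenation. Every nonempty $X$ is $Y^k$ for a unique primitive $Y=:\mathrm{root}(X)$. $\mathrm{rot}^0(X)=X$, $\mathrm{rot}^{k+1}(X)=\mathrm{rot}^k(X)[2..]\cdot\mathrm{rot}^k(X)[1]$. $\mathrm{lcp}(U,V)$ = longest common prefix length; $U<V$ iff $U$ is a proper prefix of $V$ or $U[\ell+1]<V[\ell+1]$ with $\ell=\mathrm{lcp}(U,V)$. $\mathrm{rank}_c(X,j)$ = occurrences of $c$ in $X[1..j]$. $\mathrm{PD}(V)[i]=\infty$ if $V[i]\neq\$$ and $V[i]<V[j]$ for all $j<i$; $=\$$ if $V[i]=\$$; otherwise $i-\max\{j<i:V[j]\le V[i]\}$. $\mathrm{RPD}(V)=\mathrm{PD}(V^2)[|V|+1..]$.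 $V\preceq_\omega U$ iff some natural $i$ has $\mathrm{PD}(V^\omega[..i])<\mathrm{PD}(U^\omega[..i])$ or $\mathrm{root}(\mathrm{RPD}(V))=\mathrm{root}(\mathrm{RPD}(U))$; $=_\omega$: both directions; $\prec_\omega$: $\preceq_\omega$ and not $=_\omega$. $\mathrm{lcpcount}(U,W)=\mathrm{rank}_\infty(\mathrm{PD}(U),\mathrm{lcp}(\mathrm{PD}(U),\mathrm{PD}(W)))$. $\mathrm{RTS}(V)[i]=\$$ if $V[i]=\$$, else $\mathrm{rank}_\infty(\mathrm{PD}(\mathrm{rot}^i(V)),|V|)-\mathrm{rank}_\infty(\mathrm{PD}(V[i]\cdot\mathrm{rot}^i(V))[2..],|V|)$; $\pi(V)=\mathrm{RTS}(V)[1]$. -}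

module Defs where

open import Data.Nat using (ℕ; zero; suc; _+_; _≤_; _<_; _≤ᵇ_)
open import Data.Integer as ℤ using (ℤ; +_)
open import Data.List using (List; []; _∷_; _++_; [_]; length; take; drop; concat; replicate)
open import Data.Maybe using (Maybe; just; nothing)
open import Data.Bool using (Bool; true; false; if_then_else_)
open import Data.Product using (Σ; _×_; ∃)
open import Data.Sum using (_⊎_)
open import Relation.Binary.PropositionalEquality using (_≡_; _≢_)
open import Relation.Nullary using (¬_)

-- Alphabet Σ_$ : the sentinel $ and integers (letters) drawn from ℕ.
-- ($ is smaller than every letter.)

data Chr : Set where
  $  : Chr
  ch : ℕ → Chr

Str : Set
Str = List Chr

data PSym : Set where
  $ : PSym
  num : ℕ → PSym
  ∞ : PSym

data _<P_ : PSym → PSym → Set where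
  $<num : ∀ {n} → $ <P num n
  $<∞   : $ <P ∞
  num<num : ∀ {m n} → m < n → num m <P num n
  num<∞ : ∀ {n} → num n <P ∞

_==P_ : PSym → PSym → Bool
$ ==P $ = true
num m ==P num n with m Data.Nat.≟ n
... | Relation.Nullary.yes _ = true
... | Relation.Nullary.no _ = false
∞ ==P ∞ = true
_ ==P _ = false

data _<L_ : List PSym → List PSym → Set where
  prefix : ∀ {y ys} → [] <L (y ∷ ys)
  here   : ∀ {x y xs ys} → x <P y → (x ∷ xs) <L (y ∷ ys)
  there  : ∀ {x xs ys} → xs <L ys → (x ∷ xs) <L (x ∷ ys)

-- firstLE n seen k : scanning the reversed prefix `seen` (nearest first),
-- returns k + (index of the nearest position j with V[j] ≤ ch n).
firstLE : ℕ → List Chr → ℕ → Maybe ℕ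
firstLE n [] k = nothing
firstLE n ($ ∷ s) k = just k
firstLE n (ch m ∷ s) k = if m ≤ᵇ n then just k else firstLE n s (suc k)

pdAt : List Chr → Chr → PSym
pdAt seen $ = $
pdAt seen (ch n) with firstLE n seen 1
... | nothing = ∞        -- V[i] < V[j] for all j < i
... | just d  = num d    -- i - max{ j < i : V[j] ≤ V[i] }

pdGo : List Chr → Str → List PSym
pdGo seen [] = []
pdGo seen (x ∷ xs) = pdAt seen x ∷ pdGo (x ∷ seen) xs

PD : Str → List PSym
PD = pdGo []

RPD : Str → List PSym
RPD V = drop (length V) (PD (V ++ V))

rot1 : Str → Str
rot1 [] = []
rot1 (x ∷ xs) = xs ++ [ x ]

rot : ℕ → Str → Str
rot zero X = X
rot (suc k) X = rot1 (rot k X)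

_^^_ : {A : Set} → List A → ℕ → List A
X ^^ k = concat (replicate k X)

-- V^ω[..i]  (for nonempty V, i copies of V are long enough)
omegaPrefix : Str → ℕ → Str
omegaPrefix V i = take i (V ^^ i)

Primitive : {A : Set} → List A → Set
Primitive {A} Y = (Y ≢ []) × (¬ Σ (List A) λ Z → Σ ℕ λ k → (2 ≤ k) × (Y ≡ Z ^^ k))

IsRoot : {A : Set} → List A → List A → Set
IsRoot Y X = Primitive Y × Σ ℕ λ k → (1 ≤ k) × (X ≡ Y ^^ k)

SameRoot : {A : Set} → List A → List A → Set
SameRoot {A} X X' = Σ (List A) λ Y → IsRoot Y X × IsRoot Y X'

_⪯ω_ : Str → Str → Set
V ⪯ω U = (Σ ℕ λ i → PD (omegaPrefix V i) <L PD (omegaPrefix U i))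
         ⊎ SameRoot (RPD V) (RPD U)

_=ω_ : Str → Str → Set
V =ω U = (V ⪯ω U) × (U ⪯ω V)

_≺ω_ : Str → Str → Set
V ≺ω U = (V ⪯ω U) × ¬ (V =ω U)

lcp : List PSym → List PSym → ℕ
lcp (x ∷ xs) (y ∷ ys) = if x ==P y then suc (lcp xs ys) else zero
lcp _ _ = zero

count∞ : List PSym → ℕ
count∞ [] = zero
count∞ (∞ ∷ xs) = suc (count∞ xs)
count∞ (_ ∷ xs) = count∞ xs

rank∞ : List PSym → ℕ → ℕ
rank∞ X j = count∞ (take j X)

lcpcount : Str → Str → ℕ
lcpcount U W = rank∞ (PD U) (lcp (PD U) (PD W))

data RSym : Set where
  $   : RSym
  val : ℤ → RSym

tail' : {A : Set} → List A → List A
tail' [] = []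
tail' (_ ∷ xs) = xs

-- V[i] (1-indexed), nothing if out of range
at : Str → ℕ → Maybe Chr
at V zero = nothing
at V (suc i) with drop i V
... | [] = nothing
... | x ∷ _ = just x

-- RTS(V)[i]; out-of-range positions (never used) are mapped to $.
RTS : Str → ℕ → RSym
RTS V i with at V i
... | nothing = $
... | just $ = $
... | just (ch a) =
  val (+ rank∞ (PD (rot i V)) (length V)
       ℤ.- + rank∞ (tail' (PD (ch a ∷ rot i V))) (length V))

π : Str → RSym
π V = RTS V 1

{-# OPTIONS --safe #-}
-- If V starts with $, PD(V) contains no ∞ at all.  Otherwise write V = a X, so rot V = X a and
-- PD(V) is ∞ followed by PDₐ(rot V) without its last (finite) symbol, where PDₐ(W) is PD(W)
-- recomputed as if a stood in front of W.  Passing from PD(W) to PDₐ(W) turns the ∞'s of PD(W)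
-- into distances to that a up to the first prefix minimum of W below a, after which nothing
-- changes; π(V) counts the converted ∞'s.  Run the conversion on PD(rot V) and PD(rot U) side
-- by side.  Both stop at the same ∞ inside the common prefix exactly when π(V) = π(U) < e; then
-- the converted strings keep that common prefix with π(V) fewer ∞'s and compare their
-- ω-prefixes as before, so V ≺ω U.  Otherwise they disagree before any ∞ of the common prefix,
-- and only the leading ∞ of PD(V) is shared.
module Submission where

open import Defs
open import Data.Nat using (ℕ; zero; suc; _+_; _∸_; _≤_; _<_; _≤ᵇ_; _≤?_; z≤n; s≤s; s≤s⁻¹; s<s⁻¹; z<s)
import Data.Nat.Properties as ℕ
open import Data.Integer as ℤ using (ℤ; +_; +<+)
import Data.Integer.Properties as ℤ
open import Data.List using (List; []; _∷_; _++_; [_]; length; take; drop; reverse; _ʳ++_)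
open import Data.List.Properties using (++-assoc; ++-identityʳ; ++-conicalʳ; length-++; length-++-≤ʳ; take-all; ++-ʳ++)
open import Data.List.Relation.Unary.Any as Any using (Any; here; there; any?)
open import Data.List.Relation.Unary.Any.Properties using (reverseAcc⁺; ++⁺ʳ)
open import Data.List.Membership.Propositional using (_∈_)
open import Data.Maybe using (just; nothing; maybe′; _<∣>_)
open import Data.Maybe.Properties using (<∣>-identityʳ)
open import Data.Bool using (true; false)
open import Data.Product as Product using (Σ; _×_; _,_; proj₁; proj₂)
open import Data.Sum using (_⊎_; inj₁; inj₂)
open import Function using (_∘_)
open import Function.Bundles using (_⇔_; mk⇔; Equivalence)
open import Relation.Binary.Definitions using (DecidableEquality)
open import Relation.Binary.PropositionalEquality using (_≡_; _≢_; refl; sym; trans; cong; cong₂; subst; subst₂; ≢-sym; module ≡-Reasoning)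
open import Relation.Nullary using (¬_; yes; no; contradiction)
open import Relation.Nullary.Reflects using (ofʸ; ofⁿ)
import Relation.Nullary.Decidable as Dec
open import Relation.Unary using (Decidable)

private
  variable
    T : Set
    n k l m : ℕ
    p q : PSym
    P Q A B : List PSym

open ≡-Reasoning

data Finite (n : ℕ) : PSym → Set where
  $   : Finite n $
  num : ∀ {d} → d ≤ n → Finite n (num d)

Finite⇒≢∞ : Finite n p → p ≢ ∞
Finite⇒≢∞ $       ()
Finite⇒≢∞ (num _) ()

Finite⇒≢num-suc : Finite n p → p ≢ num (suc n)
Finite⇒≢num-suc $         ()
Finite⇒≢num-suc (num d≤n) refl = ℕ.1+n≰n d≤n

count∞-finite : Finite n p → count∞ [ p ] ≡ 0
count∞-finite $       = refl
count∞-finite (num _) = refl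

count∞-∷-≢∞ : p ≢ ∞ → ∀ P → count∞ (p ∷ P) ≡ count∞ P
count∞-∷-≢∞ {$}     _   _ = refl
count∞-∷-≢∞ {num _} _   _ = refl
count∞-∷-≢∞ {∞}     p≢∞ _ = contradiction refl p≢∞

rank∞-≤ : ∀ P j → rank∞ P j ≤ count∞ P
rank∞-≤ P           zero    = z≤n
rank∞-≤ []          (suc j) = z≤n
rank∞-≤ ($ ∷ P)     (suc j) = rank∞-≤ P j
rank∞-≤ (num _ ∷ P) (suc j) = rank∞-≤ P j
rank∞-≤ (∞ ∷ P)     (suc j) = s≤s (rank∞-≤ P j)

_≟P_ : DecidableEquality PSym
$     ≟P $     = yes refl
$     ≟P num _ = no λ ()
$     ≟P ∞     = no λ ()
num _ ≟P $     = no λ ()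
num m ≟P num n = Dec.map′ (cong num) (λ { refl → refl }) (m ℕ.≟ n)
num _ ≟P ∞     = no λ ()
∞     ≟P $     = no λ ()
∞     ≟P num _ = no λ ()
∞     ≟P ∞     = yes refl

==P-refl : ∀ p → (p ==P p) ≡ true
==P-refl $ = refl
==P-refl (num n) with n ℕ.≟ n
... | yes _   = refl
... | no n≢n = contradiction refl n≢n
==P-refl ∞ = refl

≢⇒==P-false : p ≢ q → (p ==P q) ≡ false
≢⇒==P-false {$}     {$}     p≢q = contradiction refl p≢q
≢⇒==P-false {$}     {num _} _   = refl
≢⇒==P-false {$}     {∞}     _   = refl
≢⇒==P-false {num _} {$}     _   = refl
≢⇒==P-false {num m} {num n} p≢q with m ℕ.≟ n
... | yes refl = contradiction refl p≢q
... | no _     = refl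
≢⇒==P-false {num _} {∞}     _   = refl
≢⇒==P-false {∞}     {$}     _   = refl
≢⇒==P-false {∞}     {num _} _   = refl
≢⇒==P-false {∞}     {∞}     p≢q = contradiction refl p≢q

lcpRank : List PSym → List PSym → ℕ
lcpRank P Q = rank∞ P (lcp P Q)

lcpRank-∷-≡ : ∀ p P Q → lcpRank (p ∷ P) (p ∷ Q) ≡ count∞ [ p ] + lcpRank P Q
lcpRank-∷-≡ p P Q rewrite ==P-refl p with p
... | $     = refl
... | num _ = refl
... | ∞     = refl

lcpRank-∷-≢ : ∀ P Q → p ≢ q → lcpRank (p ∷ P) (q ∷ Q) ≡ 0
lcpRank-∷-≢ P Q p≢q rewrite ≢⇒==P-false p≢q = refl

<lcpRank-∷⇒≡ : k < lcpRank (p ∷ P) (q ∷ Q) → p ≡ q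
<lcpRank-∷⇒≡ {p = p} {q = q} k< with p ≟P q
... | yes p≡q = p≡q
... | no p≢q  = contradiction (subst (_ <_) (lcpRank-∷-≢ _ _ p≢q) k<) ℕ.n≮0

lcpRank-[]ʳ : ∀ P → lcpRank P [] ≡ 0
lcpRank-[]ʳ []      = refl
lcpRank-[]ʳ (_ ∷ _) = refl

lcpRank-∷ʳ : ∀ {u v} P Q → u ≢ ∞ → v ≢ ∞ → lcpRank (P ++ [ u ]) (Q ++ [ v ]) ≡ lcpRank P Q
lcpRank-∷ʳ {u} {v} [] Q u≢∞ _ = ℕ.n≤0⇒n≡0 (ℕ.≤-trans (rank∞-≤ [ u ] (lcp [ u ] (Q ++ [ v ])))
                                                      (ℕ.≤-reflexive (count∞-∷-≢∞ u≢∞ [])))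
lcpRank-∷ʳ {u} {v} (p ∷ P) [] _ v≢∞ with p ≟P v
... | no p≢v = lcpRank-∷-≢ _ _ p≢v
... | yes refl
  rewrite lcpRank-∷-≡ v (P ++ [ u ]) [] | lcpRank-[]ʳ (P ++ [ u ]) | count∞-∷-≢∞ v≢∞ [] = refl
lcpRank-∷ʳ {u} {v} (p ∷ P) (q ∷ Q) u≢∞ v≢∞ with p ≟P q
... | no p≢q = trans (lcpRank-∷-≢ _ _ p≢q) (sym (lcpRank-∷-≢ _ _ p≢q))
... | yes refl rewrite lcpRank-∷-≡ p (P ++ [ u ]) (Q ++ [ v ]) | lcpRank-∷-≡ p P Q =
  cong (_+_ (count∞ [ p ])) (lcpRank-∷ʳ P Q u≢∞ v≢∞)

-- Converting leading ∞'s into distances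

-- Converts n k P A: P is a PD string whose first position has n predecessors, and A is P
-- recomputed with one more symbol in front of them.  The first k ∞'s of P become distances
-- to that symbol; the first ∞ that survives ends all changes.
data Converts : ℕ → ℕ → List PSym → List PSym → Set where
  []      : Converts n 0 [] []
  keep    : Finite n p → Converts (suc n) k P A → Converts n k (p ∷ P) (p ∷ A)
  convert : Converts (suc n) k P A → Converts n (suc k) (∞ ∷ P) (num (suc n) ∷ A)
  stop    : Converts n 0 (∞ ∷ P) (∞ ∷ P)

count∞-converts : Converts n k P A → count∞ P ≡ k + count∞ A
count∞-converts []               = refl
count∞-converts (keep $ c)       = count∞-converts c
count∞-converts (keep (num _) c) = count∞-converts c
count∞-converts (convert c)      = cong suc (count∞-converts c)
count∞-converts stop             = refl

data CommonPrefixReplaced : List PSym → List PSym → List PSym → List PSym → Set where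
  unchanged : CommonPrefixReplaced P Q P Q
  replace   : ∀ {a} → CommonPrefixReplaced P Q A B →
              CommonPrefixReplaced (p ∷ P) (p ∷ Q) (a ∷ A) (a ∷ B)

replaced-sym : CommonPrefixReplaced P Q A B → CommonPrefixReplaced A B P Q
replaced-sym unchanged   = unchanged
replaced-sym (replace r) = replace (replaced-sym r)

replaced-swap : CommonPrefixReplaced P Q A B → CommonPrefixReplaced Q P B A
replaced-swap unchanged   = unchanged
replaced-swap (replace r) = replace (replaced-swap r)

<P-irrefl : ¬ (p <P p)
<P-irrefl (num<num m<m) = ℕ.<-irrefl refl m<m

<L-∷-cancel : (p ∷ P) <L (p ∷ Q) → P <L Q
<L-∷-cancel (here p<p)  = contradiction p<p <P-irrefl
<L-∷-cancel (there P<Q) = P<Q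

replaced-<L : CommonPrefixReplaced P Q A B → ∀ i R S →
              take i (P ++ R) <L take i (Q ++ S) → take i (A ++ R) <L take i (B ++ S)
replaced-<L unchanged   i       R S lt = lt
replaced-<L (replace r) zero    R S ()
replaced-<L (replace r) (suc i) R S lt = there (replaced-<L r i R S (<L-∷-cancel lt))

converts-agree : Converts n k P A → Converts n k Q B → k < lcpRank P Q →
                 lcpRank P Q ≡ k + lcpRank A B × CommonPrefixReplaced P Q A B
converts-agree (keep {p = p} {P = P} {A = A} fp c) (keep {p = q} {P = Q} {A = B} _ d) k<
  with refl ← <lcpRank-∷⇒≡ {p = p} {q = q} k<
  rewrite lcpRank-∷-≡ p P Q | lcpRank-∷-≡ p A B | count∞-finite fp =
  Product.map₂ replace (converts-agree c d k<)
converts-agree (convert {n = n} {P = P} {A = A} c) (convert {P = Q} {A = B} d) k<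
  rewrite lcpRank-∷-≡ ∞ P Q | lcpRank-∷-≡ (num (suc n)) A B =
  Product.map (cong suc) replace (converts-agree c d (s<s⁻¹ k<))
converts-agree stop        stop        _  = refl , unchanged
converts-agree (keep fp _) (convert _) k< = contradiction (<lcpRank-∷⇒≡ k<) (Finite⇒≢∞ fp)
converts-agree (keep fp _) stop        k< = contradiction (<lcpRank-∷⇒≡ k<) (Finite⇒≢∞ fp)
converts-agree (convert _) (keep fq _) k< = contradiction (<lcpRank-∷⇒≡ k<) (≢-sym (Finite⇒≢∞ fq))
converts-agree stop        (keep fq _) k< = contradiction (<lcpRank-∷⇒≡ k<) (≢-sym (Finite⇒≢∞ fq))

converts-disagree : Converts n k P A → Converts n l Q B → ¬ (k ≡ l × k < lcpRank P Q) →
                    lcpRank A B ≡ 0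
converts-disagree []          _  _ = refl
converts-disagree (keep _ _)  [] _ = refl
converts-disagree (convert _) [] _ = refl
converts-disagree stop        [] _ = refl
converts-disagree (keep {p = p} {P = P} {A = A} fp c) (keep {p = q} {P = Q} {A = B} _ d) ¬agree
  with p ≟P q
... | no p≢q = lcpRank-∷-≢ A B p≢q
... | yes refl rewrite lcpRank-∷-≡ p P Q | lcpRank-∷-≡ p A B | count∞-finite fp =
  converts-disagree c d ¬agree
converts-disagree (convert {n = n} {P = P} {A = A} c) (convert {P = Q} {A = B} d) ¬agree
  rewrite lcpRank-∷-≡ ∞ P Q | lcpRank-∷-≡ (num (suc n)) A B =
  converts-disagree c d λ (k≡l , k<) → ¬agree (cong suc k≡l , s≤s k<)
converts-disagree {P = ∞ ∷ P} {Q = ∞ ∷ Q} stop stop ¬agree =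
  contradiction (refl , subst (0 <_) (sym (lcpRank-∷-≡ ∞ P Q)) z<s) ¬agree
converts-disagree (keep fp _) (convert _) _ = lcpRank-∷-≢ _ _ (Finite⇒≢num-suc fp)
converts-disagree (keep fp _) stop        _ = lcpRank-∷-≢ _ _ (Finite⇒≢∞ fp)
converts-disagree (convert _) (keep fq _) _ = lcpRank-∷-≢ _ _ (≢-sym (Finite⇒≢num-suc fq))
converts-disagree stop        (keep fq _) _ = lcpRank-∷-≢ _ _ (≢-sym (Finite⇒≢∞ fq))
converts-disagree (convert {n = n} {A = A} _) (stop {P = B}) _ =
  lcpRank-∷-≢ {p = num (suc n)} {q = ∞} A B λ ()
converts-disagree (stop {P = A}) (convert {n = n} {A = B} _) _ =
  lcpRank-∷-≢ {p = ∞} {q = num (suc n)} A B λ ()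

-- Prepending a letter to the context of PD

data AtMost (m : ℕ) : Chr → Set where
  $  : AtMost m $
  ch : ∀ {n} → n ≤ m → AtMost m (ch n)

atMost? : ∀ m → Decidable (AtMost m)
atMost? m $      = yes $
atMost? m (ch n) = Dec.map′ ch (λ { (ch n≤m) → n≤m }) (n ≤? m)

AtMost-mono : ∀ {c} → m ≤ n → AtMost m c → AtMost n c
AtMost-mono _   $         = $
AtMost-mono m≤n (ch j≤m) = ch (ℕ.≤-trans j≤m m≤n)

firstLE-++ : ∀ m s t k → firstLE m (s ++ t) k ≡ (firstLE m s k <∣> firstLE m t (k + length s))
firstLE-++ m []         t k = cong (firstLE m t) (sym (ℕ.+-identityʳ k))
firstLE-++ m ($ ∷ s)    t k = refl
firstLE-++ m (ch n ∷ s) t k with n ≤ᵇ m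
... | true  = refl
... | false = trans (firstLE-++ m s t (suc k))
                    (cong (λ j → firstLE m s (suc k) <∣> firstLE m t j) (sym (ℕ.+-suc k (length s))))

firstLE-found : ∀ {s} → Any (AtMost m) s → ∀ k → firstLE m s k ≢ nothing
firstLE-found {s = $ ∷ _} _ _ ()
firstLE-found {m} {ch n ∷ _} found k with n ≤ᵇ m | ℕ.≤ᵇ-reflects-≤ n m | found
... | true  | _       | _             = λ ()
... | false | ofⁿ n≰m | here (ch n≤m) = contradiction n≤m n≰m
... | false | _       | there found′  = firstLE-found found′ (suc k)

firstLE-missed : ∀ {s} → ¬ Any (AtMost m) s → ∀ k → firstLE m s k ≡ nothing
firstLE-missed {s = []}    _    _ = refl
firstLE-missed {s = $ ∷ _} none _ = contradiction (here $) none
firstLE-missed {m} {ch n ∷ _} none k with n ≤ᵇ m | ℕ.≤ᵇ-reflects-≤ n m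
... | true  | ofʸ n≤m = contradiction (here (ch n≤m)) none
... | false | _       = firstLE-missed (none ∘ there) (suc k)

firstLE-bound : ∀ m s k {d} → firstLE m s k ≡ just d → d < k + length s
firstLE-bound m ($ ∷ s) k refl = ℕ.m<m+n k z<s
firstLE-bound m (ch n ∷ s) k {d} eq with n ≤ᵇ m | eq
... | true  | refl = ℕ.m<m+n k z<s
... | false | eq′  = subst (d <_) (sym (ℕ.+-suc k (length s))) (firstLE-bound m s (suc k) eq′)

pdAt-ch : ∀ s m → pdAt s (ch m) ≡ maybe′ num ∞ (firstLE m s 1)
pdAt-ch s m with firstLE m s 1
... | nothing = refl
... | just _  = refl

pdAt-finite : ∀ {s} → Any (AtMost m) s → Finite (length s) (pdAt s (ch m))
pdAt-finite {m} {s} found rewrite pdAt-ch s m with firstLE m s 1 in eq | firstLE-found found 1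
... | nothing | ≢nothing = contradiction refl ≢nothing
... | just d  | _        = num (s≤s⁻¹ (firstLE-bound m s 1 eq))

pdAt-missed : ∀ {s} → ¬ Any (AtMost m) s → pdAt s (ch m) ≡ ∞
pdAt-missed {m} {s} missed = trans (pdAt-ch s m) (cong (maybe′ num ∞) (firstLE-missed missed 1))

pdAt-++-irrelevant : ∀ s t → Any (AtMost m) s ⊎ ¬ Any (AtMost m) t →
                     pdAt (s ++ t) (ch m) ≡ pdAt s (ch m)
pdAt-++-irrelevant {m} s t irrelevant = begin
  pdAt (s ++ t) (ch m)
    ≡⟨ pdAt-ch (s ++ t) m ⟩
  maybe′ num ∞ (firstLE m (s ++ t) 1)
    ≡⟨ cong (maybe′ num ∞) (firstLE-++ m s t 1) ⟩
  maybe′ num ∞ (firstLE m s 1 <∣> firstLE m t (suc (length s)))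
    ≡⟨ cong (maybe′ num ∞) (unreached irrelevant) ⟩
  maybe′ num ∞ (firstLE m s 1)
    ≡⟨ pdAt-ch s m ⟨
  pdAt s (ch m) ∎
  where
  unreached : Any (AtMost m) s ⊎ ¬ Any (AtMost m) t →
              (firstLE m s 1 <∣> firstLE m t (suc (length s))) ≡ firstLE m s 1
  unreached (inj₁ found) with firstLE m s 1 | firstLE-found found 1
  ... | just _  | _        = refl
  ... | nothing | ≢nothing = contradiction refl ≢nothing
  unreached (inj₂ missed) =
    trans (cong (firstLE m s 1 <∣>_) (firstLE-missed missed _)) (<∣>-identityʳ _)

pdAt-∷ʳ-shadowed : ∀ {a s} → Any (AtMost a) s → ∀ x → pdAt (s ++ [ ch a ]) x ≡ pdAt s x
pdAt-∷ʳ-shadowed _ $ = refl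
pdAt-∷ʳ-shadowed {a} {s} found (ch m) with a ≤? m
... | yes a≤m = pdAt-++-irrelevant s _ (inj₁ (Any.map (AtMost-mono a≤m) found))
... | no a≰m  = pdAt-++-irrelevant s _ (inj₂ λ { (here (ch a≤m)) → a≰m a≤m })

pdGo-∷ʳ-shadowed : ∀ {a s} → Any (AtMost a) s → ∀ W → pdGo (s ++ [ ch a ]) W ≡ pdGo s W
pdGo-∷ʳ-shadowed _     []      = refl
pdGo-∷ʳ-shadowed found (x ∷ W) =
  cong₂ _∷_ (pdAt-∷ʳ-shadowed found x) (pdGo-∷ʳ-shadowed (there found) W)

pdAt-converted : ∀ {a s} → ¬ Any (AtMost m) s → a ≤ m →
                 pdAt (s ++ [ ch a ]) (ch m) ≡ num (suc (length s))
pdAt-converted {m} {a} {s} missed a≤m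
  rewrite pdAt-ch (s ++ [ ch a ]) m | firstLE-++ m s [ ch a ] 1 | firstLE-missed missed 1
  with a ≤ᵇ m | ℕ.≤ᵇ-reflects-≤ a m
... | true  | _        = refl
... | false | ofⁿ a≰m = contradiction a≤m a≰m

pdGo-converts : ∀ a s W → Σ ℕ λ k → Converts (length s) k (pdGo s W) (pdGo (s ++ [ ch a ]) W)
pdGo-converts a s []      = 0 , []
pdGo-converts a s ($ ∷ W) = Product.map₂ (keep $) (pdGo-converts a ($ ∷ s) W)
pdGo-converts a s (ch m ∷ W) with any? (atMost? m) s
... | yes found rewrite pdAt-++-irrelevant s [ ch a ] (inj₁ found) =
  Product.map₂ (keep (pdAt-finite found)) (pdGo-converts a (ch m ∷ s) W)
... | no missed with a ≤? m
...   | yes a≤m rewrite pdAt-missed missed | pdAt-converted missed a≤m =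
  Product.map suc convert (pdGo-converts a (ch m ∷ s) W)
...   | no a≰m
  rewrite pdAt-++-irrelevant s [ ch a ] (inj₂ λ { (here (ch a≤m)) → a≰m a≤m })
        | pdAt-missed missed
        | pdGo-∷ʳ-shadowed {a} {ch m ∷ s} (here (ch (ℕ.<⇒≤ (ℕ.≰⇒> a≰m)))) W = 0 , stop

pdGo-++ : ∀ s W M → pdGo s (W ++ M) ≡ pdGo s W ++ pdGo (W ʳ++ s) M
pdGo-++ s []      M = refl
pdGo-++ s (x ∷ W) M = cong (pdAt s x ∷_) (pdGo-++ (x ∷ s) W M)

pdGo-take : ∀ s i W → pdGo s (take i W) ≡ take i (pdGo s W)
pdGo-take s zero    W       = refl
pdGo-take s (suc i) []      = refl
pdGo-take s (suc i) (x ∷ W) = cong (pdAt s x ∷_) (pdGo-take (x ∷ s) i W)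

length-pdGo : ∀ s W → length (pdGo s W) ≡ length W
length-pdGo s []      = refl
length-pdGo s (x ∷ W) = cong suc (length-pdGo (x ∷ s) W)

count∞-pdGo-$ : ∀ {s} → $ ∈ s → ∀ W → count∞ (pdGo s W) ≡ 0
count∞-pdGo-$ _   []         = refl
count∞-pdGo-$ $∈s ($ ∷ W)    = count∞-pdGo-$ (there $∈s) W
count∞-pdGo-$ $∈s (ch m ∷ W) = trans
  (count∞-∷-≢∞ (Finite⇒≢∞ (pdAt-finite (Any.map (λ { refl → $ }) $∈s))) _)
  (count∞-pdGo-$ (there $∈s) W)

conversions : ℕ → Str → ℕ
conversions a W = proj₁ (pdGo-converts a [] W)

conversions-converts : ∀ a W → Converts 0 (conversions a W) (PD W) (pdGo [ ch a ] W)
conversions-converts a W = proj₂ (pdGo-converts a [] W)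

[+m]-[+n]≡+[m∸n] : n ≤ m → + m ℤ.- + n ≡ + (m ∸ n)
[+m]-[+n]≡+[m∸n] {n} {m} n≤m = trans (ℤ.[+m]-[+n]≡m⊖n m n) (ℤ.⊖-≥ n≤m)

rank∞-pdGo-all : ∀ s W {j} → length W ≤ j → rank∞ (pdGo s W) j ≡ count∞ (pdGo s W)
rank∞-pdGo-all s W {j} W≤j =
  cong count∞ (take-all j (pdGo s W) (ℕ.≤-trans (ℕ.≤-reflexive (length-pdGo s W)) W≤j))

π-∷ : ∀ a X → π (ch a ∷ X) ≡ val (+ conversions a (X ++ [ ch a ]))
π-∷ a X = cong val (begin
  + rank∞ (PD W) (suc (length X)) ℤ.- + rank∞ PDₐ (suc (length X))
    ≡⟨ cong₂ (λ i j → + i ℤ.- + j) (trans (rank∞-pdGo-all [] W W≤) count∞-W)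
                                   (rank∞-pdGo-all [ ch a ] W W≤) ⟩
  + (κ + count∞ PDₐ) ℤ.- + count∞ PDₐ  ≡⟨ [+m]-[+n]≡+[m∸n] (ℕ.m≤n+m (count∞ PDₐ) κ) ⟩
  + (κ + count∞ PDₐ ∸ count∞ PDₐ)      ≡⟨ cong +_ (ℕ.m+n∸n≡m κ (count∞ PDₐ)) ⟩
  + κ                                  ∎)
  where
  W : Str
  W = X ++ [ ch a ]
  PDₐ : List PSym
  PDₐ = pdGo [ ch a ] W
  κ : ℕ
  κ = conversions a W
  W≤ : length W ≤ suc (length X)
  W≤ = ℕ.≤-reflexive (trans (length-++ X) (ℕ.+-comm (length X) 1))
  count∞-W : count∞ (PD W) ≡ κ + count∞ PDₐ
  count∞-W = count∞-converts (conversions-converts a W)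

lcpcount-$∷ : ∀ X U → lcpcount ($ ∷ X) U ≡ 0
lcpcount-$∷ X U = ℕ.n≤0⇒n≡0 (ℕ.≤-trans (rank∞-≤ (PD ($ ∷ X)) (lcp (PD ($ ∷ X)) (PD U)))
                                        (ℕ.≤-reflexive (count∞-pdGo-$ (here refl) X)))

self-∈ʳ++ : ∀ a X → Any (AtMost a) (X ʳ++ [ ch a ])
self-∈ʳ++ a X = reverseAcc⁺ [ ch a ] X (inj₁ (here (ch ℕ.≤-refl)))

lcpcount-∷ : ∀ a b X Y → lcpcount (ch a ∷ X) (ch b ∷ Y)
                         ≡ suc (lcpRank (pdGo [ ch a ] (X ++ [ ch a ])) (pdGo [ ch b ] (Y ++ [ ch b ])))
lcpcount-∷ a b X Y = begin
  lcpcount (ch a ∷ X) (ch b ∷ Y)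
    ≡⟨ lcpRank-∷-≡ ∞ (pdGo [ ch a ] X) (pdGo [ ch b ] Y) ⟩
  suc (lcpRank (pdGo [ ch a ] X) (pdGo [ ch b ] Y))
    ≡⟨ cong suc (lcpRank-∷ʳ (pdGo [ ch a ] X) (pdGo [ ch b ] Y) (last≢∞ a X) (last≢∞ b Y)) ⟨
  suc (lcpRank (pdGo [ ch a ] X ++ [ last a X ]) (pdGo [ ch b ] Y ++ [ last b Y ]))
    ≡⟨ cong suc (cong₂ lcpRank (pdGo-++ [ ch a ] X [ ch a ]) (pdGo-++ [ ch b ] Y [ ch b ])) ⟨
  suc (lcpRank (pdGo [ ch a ] (X ++ [ ch a ])) (pdGo [ ch b ] (Y ++ [ ch b ]))) ∎
  where
  last : ℕ → Str → PSym
  last c Z = pdAt (Z ʳ++ [ ch c ]) (ch c)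
  last≢∞ : ∀ c Z → last c Z ≢ ∞
  last≢∞ c Z = Finite⇒≢∞ (pdAt-finite (self-∈ʳ++ c Z))

-- Powers and rotations

^^-∷-shift : ∀ (c : T) X i → X ++ (c ∷ X) ^^ i ≡ (X ++ [ c ]) ^^ i ++ X
^^-∷-shift c X zero    = ++-identityʳ X
^^-∷-shift c X (suc i) = begin
  X ++ c ∷ X ++ (c ∷ X) ^^ i                ≡⟨ ++-assoc X [ c ] (X ++ (c ∷ X) ^^ i) ⟨
  (X ++ [ c ]) ++ X ++ (c ∷ X) ^^ i          ≡⟨ cong ((X ++ [ c ]) ++_) (^^-∷-shift c X i) ⟩
  (X ++ [ c ]) ++ (X ++ [ c ]) ^^ i ++ X     ≡⟨ ++-assoc (X ++ [ c ]) ((X ++ [ c ]) ^^ i) X ⟨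
  ((X ++ [ c ]) ++ (X ++ [ c ]) ^^ i) ++ X   ∎

^^-++-comm : ∀ (Y : List T) i → Y ^^ i ++ Y ≡ Y ++ Y ^^ i
^^-++-comm Y zero    = sym (++-identityʳ Y)
^^-++-comm Y (suc i) = trans (++-assoc Y (Y ^^ i) Y) (cong (Y ++_) (^^-++-comm Y i))

length-^^-≥ : ∀ (Y : List T) → Y ≢ [] → ∀ i → i ≤ length (Y ^^ i)
length-^^-≥ []      Y≢[] _       = contradiction refl Y≢[]
length-^^-≥ (y ∷ Y) _    zero    = z≤n
length-^^-≥ (y ∷ Y) Y≢[] (suc i) =
  s≤s (ℕ.≤-trans (length-^^-≥ (y ∷ Y) Y≢[] i) (length-++-≤ʳ ((y ∷ Y) ^^ i) {Y}))

∷ʳ-≢[] : ∀ (X : List T) {x} → X ++ [ x ] ≢ []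
∷ʳ-≢[] X eq with () ← ++-conicalʳ X _ eq

take-++-≤ : ∀ i (X Y : List T) → i ≤ length X → take i (X ++ Y) ≡ take i X
take-++-≤ zero    X       Y _         = refl
take-++-≤ (suc i) (x ∷ X) Y (s≤s i≤X) = cong (x ∷_) (take-++-≤ i X Y i≤X)

ʳ++-++-assoc : ∀ (X Y Z : List T) → X ʳ++ (Y ++ Z) ≡ (X ʳ++ Y) ++ Z
ʳ++-++-assoc []      Y Z = refl
ʳ++-++-assoc (x ∷ X) Y Z = ʳ++-++-assoc X (x ∷ Y) Z

rotate : List T → List T
rotate []      = []
rotate (x ∷ X) = X ++ [ x ]

rotate-^^ : ∀ (Z : List T) i → rotate (Z ^^ i) ≡ rotate Z ^^ i
rotate-^^ Z       zero    = refl
rotate-^^ []      (suc i) = rotate-^^ [] i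
rotate-^^ (z ∷ Z) (suc i) = begin
  (Z ++ (z ∷ Z) ^^ i) ++ [ z ]          ≡⟨ cong (_++ [ z ]) (^^-∷-shift z Z i) ⟩
  ((Z ++ [ z ]) ^^ i ++ Z) ++ [ z ]     ≡⟨ ++-assoc ((Z ++ [ z ]) ^^ i) Z [ z ] ⟩
  (Z ++ [ z ]) ^^ i ++ Z ++ [ z ]       ≡⟨ ^^-++-comm (Z ++ [ z ]) i ⟩
  (Z ++ [ z ]) ++ (Z ++ [ z ]) ^^ i     ∎

rotateⁿ : ℕ → List T → List T
rotateⁿ zero    X = X
rotateⁿ (suc j) X = rotateⁿ j (rotate X)

rotateⁿ-^^ : ∀ j (Z : List T) i → rotateⁿ j (Z ^^ i) ≡ rotateⁿ j Z ^^ i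
rotateⁿ-^^ zero    Z i = refl
rotateⁿ-^^ (suc j) Z i = trans (cong (rotateⁿ j) (rotate-^^ Z i)) (rotateⁿ-^^ j (rotate Z) i)

rotateⁿ-++ : ∀ (X Y : List T) → rotateⁿ (length X) (X ++ Y) ≡ Y ++ X
rotateⁿ-++ []      Y = sym (++-identityʳ Y)
rotateⁿ-++ (x ∷ X) Y = begin
  rotateⁿ (length X) ((X ++ Y) ++ [ x ])  ≡⟨ cong (rotateⁿ (length X)) (++-assoc X Y [ x ]) ⟩
  rotateⁿ (length X) (X ++ Y ++ [ x ])    ≡⟨ rotateⁿ-++ X (Y ++ [ x ]) ⟩
  (Y ++ [ x ]) ++ X                       ≡⟨ ++-assoc Y [ x ] X ⟩
  Y ++ x ∷ X                              ∎

Primitive-rotate : ∀ (Y : List T) → Primitive Y → Primitive (rotate Y)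
Primitive-rotate []      (Y≢[] , _) = contradiction refl Y≢[]
Primitive-rotate (y ∷ Y) (_ , unsplittable) = ∷ʳ-≢[] Y , λ (Z , i , 2≤i , Y∷ʳy≡Z^i) →
  unsplittable (rotateⁿ (length Y) Z , i , 2≤i , (begin
    y ∷ Y                            ≡⟨ rotateⁿ-++ Y [ y ] ⟨
    rotateⁿ (length Y) (Y ++ [ y ])  ≡⟨ cong (rotateⁿ (length Y)) Y∷ʳy≡Z^i ⟩
    rotateⁿ (length Y) (Z ^^ i)      ≡⟨ rotateⁿ-^^ (length Y) Z i ⟩
    rotateⁿ (length Y) Z ^^ i        ∎))

IsRoot-rotate : ∀ {Y X : List T} → IsRoot Y X → IsRoot (rotate Y) (rotate X)
IsRoot-rotate {Y = Y} (Y-primitive , i , 1≤i , X≡Y^i) =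
  Primitive-rotate Y Y-primitive , i , 1≤i , trans (cong rotate X≡Y^i) (rotate-^^ Y i)

SameRoot-rotate : ∀ {X X′ : List T} → SameRoot X X′ → SameRoot (rotate X) (rotate X′)
SameRoot-rotate (Y , root , root′) = rotate Y , IsRoot-rotate root , IsRoot-rotate root′

SameRoot-sym : ∀ {X X′ : List T} → SameRoot X X′ → SameRoot X′ X
SameRoot-sym (Y , root , root′) = Y , root′ , root

drop-length-++ : ∀ (X Y : List T) → drop (length X) (X ++ Y) ≡ Y
drop-length-++ []      Y = refl
drop-length-++ (x ∷ X) Y = drop-length-++ X Y

RPD-pdGo : ∀ W → RPD W ≡ pdGo (reverse W) W
RPD-pdGo W = begin
  drop (length W) (pdGo [] (W ++ W))
    ≡⟨ cong (drop (length W)) (pdGo-++ [] W W) ⟩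
  drop (length W) (pdGo [] W ++ pdGo (reverse W) W)
    ≡⟨ cong (λ j → drop j (pdGo [] W ++ pdGo (reverse W) W)) (length-pdGo [] W) ⟨
  drop (length (pdGo [] W)) (pdGo [] W ++ pdGo (reverse W) W)
    ≡⟨ drop-length-++ (pdGo [] W) _ ⟩
  pdGo (reverse W) W ∎

RPD-rot1 : ∀ a X → RPD (rot1 (ch a ∷ X)) ≡ rotate (RPD (ch a ∷ X))
RPD-rot1 a X = begin
  RPD (X ++ [ ch a ])
    ≡⟨ RPD-pdGo (X ++ [ ch a ]) ⟩
  pdGo ((X ++ [ ch a ]) ʳ++ []) (X ++ [ ch a ])
    ≡⟨ cong (λ s → pdGo s (X ++ [ ch a ])) (++-ʳ++ X) ⟩
  pdGo (ch a ∷ reverse X) (X ++ [ ch a ])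
    ≡⟨ pdGo-++ (ch a ∷ reverse X) X [ ch a ] ⟩
  pdGo (ch a ∷ reverse X) X ++ [ pdAt (X ʳ++ ch a ∷ reverse X) (ch a) ]
    ≡⟨ cong₂ (λ P p → P ++ [ p ]) (sym shadowed) unreached ⟩
  pdGo (ch a ∷ X ʳ++ [ ch a ]) X ++ [ pdAt (X ʳ++ [ ch a ]) (ch a) ]
    ≡⟨ cong rotate (RPD-pdGo (ch a ∷ X)) ⟨
  rotate (RPD (ch a ∷ X)) ∎
  where
  shadowed : pdGo (ch a ∷ X ʳ++ [ ch a ]) X ≡ pdGo (ch a ∷ reverse X) X
  shadowed = trans (cong (λ s → pdGo (ch a ∷ s) X) (ʳ++-++-assoc X [] [ ch a ]))
                   (pdGo-∷ʳ-shadowed (here (ch ℕ.≤-refl)) X)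
  unreached : pdAt (X ʳ++ ch a ∷ reverse X) (ch a) ≡ pdAt (X ʳ++ [ ch a ]) (ch a)
  unreached = trans (cong (λ s → pdAt s (ch a)) (ʳ++-++-assoc X [ ch a ] (reverse X)))
                    (pdAt-++-irrelevant (X ʳ++ [ ch a ]) (reverse X) (inj₁ (self-∈ʳ++ a X)))

omegaPrefix-∷ : ∀ c X i → omegaPrefix (c ∷ X) (suc i) ≡ c ∷ omegaPrefix (X ++ [ c ]) i
omegaPrefix-∷ c X i = cong (c ∷_) (begin
  take i (X ++ (c ∷ X) ^^ i)            ≡⟨ cong (take i) (^^-∷-shift c X i) ⟩
  take i ((X ++ [ c ]) ^^ i ++ X)       ≡⟨ take-++-≤ i _ X (length-^^-≥ (X ++ [ c ]) (∷ʳ-≢[] X) i) ⟩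
  take i ((X ++ [ c ]) ^^ i)            ∎)

omegaPrefix-take : ∀ W i → Σ Str λ N → omegaPrefix W i ≡ take i (W ++ N)
omegaPrefix-take W zero    = [] , refl
omegaPrefix-take W (suc i) = W ^^ i , refl

-- Both ω-prefixes continue PD(rot V) and its converted form with the same symbols,
-- because the letter a inside rot V hides the prepended a from everything after it.
PD-omegaPrefix : ∀ a X i → Σ (List PSym) λ M →
    PD (omegaPrefix (X ++ [ ch a ]) i) ≡ take i (PD (X ++ [ ch a ]) ++ M)
  × PD (omegaPrefix (ch a ∷ X) (suc i)) ≡ ∞ ∷ take i (pdGo [ ch a ] (X ++ [ ch a ]) ++ M)
PD-omegaPrefix a X i = pdGo (reverse W) N , rotated , unrotated
  where
  W : Str
  W = X ++ [ ch a ]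
  N : Str
  N = proj₁ (omegaPrefix-take W i)
  W^i≡ : omegaPrefix W i ≡ take i (W ++ N)
  W^i≡ = proj₂ (omegaPrefix-take W i)
  rotated : PD (omegaPrefix W i) ≡ take i (PD W ++ pdGo (reverse W) N)
  rotated = begin
    PD (omegaPrefix W i)        ≡⟨ cong PD W^i≡ ⟩
    PD (take i (W ++ N))        ≡⟨ pdGo-take [] i (W ++ N) ⟩
    take i (PD (W ++ N))        ≡⟨ cong (take i) (pdGo-++ [] W N) ⟩
    take i (PD W ++ pdGo (reverse W) N) ∎
  a∈W : Any (AtMost a) (reverse W)
  a∈W = reverseAcc⁺ [] W (inj₂ (++⁺ʳ X (here (ch ℕ.≤-refl))))
  unrotated : PD (omegaPrefix (ch a ∷ X) (suc i)) ≡ ∞ ∷ take i (pdGo [ ch a ] W ++ pdGo (reverse W) N)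
  unrotated = trans (cong PD (omegaPrefix-∷ (ch a) X i)) (cong (∞ ∷_) (begin
    pdGo [ ch a ] (omegaPrefix W i)
      ≡⟨ cong (pdGo [ ch a ]) W^i≡ ⟩
    pdGo [ ch a ] (take i (W ++ N))
      ≡⟨ pdGo-take [ ch a ] i (W ++ N) ⟩
    take i (pdGo [ ch a ] (W ++ N))
      ≡⟨ cong (take i) (pdGo-++ [ ch a ] W N) ⟩
    take i (pdGo [ ch a ] W ++ pdGo (W ʳ++ [ ch a ]) N)
      ≡⟨ cong (λ s → take i (pdGo [ ch a ] W ++ pdGo s N)) (ʳ++-++-assoc W [] [ ch a ]) ⟩
    take i (pdGo [ ch a ] W ++ pdGo (reverse W ++ [ ch a ]) N)
      ≡⟨ cong (λ M → take i (pdGo [ ch a ] W ++ M)) (pdGo-∷ʳ-shadowed a∈W N) ⟩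
    take i (pdGo [ ch a ] W ++ pdGo (reverse W) N) ∎))

omegaPrefix-<L-∷ : ∀ {a b X Y} →
  CommonPrefixReplaced (PD (X ++ [ ch a ])) (PD (Y ++ [ ch b ]))
                       (pdGo [ ch a ] (X ++ [ ch a ])) (pdGo [ ch b ] (Y ++ [ ch b ])) → ∀ i →
  PD (omegaPrefix (ch a ∷ X) (suc i)) <L PD (omegaPrefix (ch b ∷ Y) (suc i))
    ⇔ PD (omegaPrefix (X ++ [ ch a ]) i) <L PD (omegaPrefix (Y ++ [ ch b ]) i)
omegaPrefix-<L-∷ {a} {b} {X} {Y} r i
  with M , V-rot , V-unrot ← PD-omegaPrefix a X i
  with N , U-rot , U-unrot ← PD-omegaPrefix b Y i
  rewrite V-rot | V-unrot | U-rot | U-unrot =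
  mk⇔ (replaced-<L (replaced-sym r) i M N ∘ <L-∷-cancel) (there ∘ replaced-<L r i M N)

≺ω-∷ : ∀ {a b X Y} →
  CommonPrefixReplaced (PD (X ++ [ ch a ])) (PD (Y ++ [ ch b ]))
                       (pdGo [ ch a ] (X ++ [ ch a ])) (pdGo [ ch b ] (Y ++ [ ch b ])) →
  rot1 (ch a ∷ X) ≺ω rot1 (ch b ∷ Y) → (ch a ∷ X) ≺ω (ch b ∷ Y)
≺ω-∷ _ (inj₂ same , rot≉) = contradiction (inj₂ same , inj₂ (SameRoot-sym same)) rot≉
≺ω-∷ {a} {b} {X} {Y} r (inj₁ (i , rot<) , rot≉) =
  inj₁ (suc i , Equivalence.from (omegaPrefix-<L-∷ r i) rot<) ,
  λ (_ , U⪯V) → rot≉ (inj₁ (i , rot<) , rot1-⪯ω U⪯V)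
  where
  rot1-⪯ω : (ch b ∷ Y) ⪯ω (ch a ∷ X) → rot1 (ch b ∷ Y) ⪯ω rot1 (ch a ∷ X)
  rot1-⪯ω (inj₁ (zero , ()))
  rot1-⪯ω (inj₁ (suc j , U<V)) = inj₁ (j , Equivalence.to (omegaPrefix-<L-∷ (replaced-swap r) j) U<V)
  rot1-⪯ω (inj₂ same) =
    inj₂ (subst₂ SameRoot (sym (RPD-rot1 b Y)) (sym (RPD-rot1 a X)) (SameRoot-rotate same))

val-injective : ∀ {z w} → val z ≡ val w → z ≡ w
val-injective refl = refl

+suc≡[+m+n]-[+m]+1 : ∀ m n → + suc n ≡ + (m + n) ℤ.- + m ℤ.+ + 1
+suc≡[+m+n]-[+m]+1 m n = begin
  + suc n                     ≡⟨ cong +_ (ℕ.+-comm 1 n) ⟩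
  + n ℤ.+ + 1                 ≡⟨ cong (λ i → + i ℤ.+ + 1) (ℕ.m+n∸m≡n m n) ⟨
  + (m + n ∸ m) ℤ.+ + 1       ≡⟨ cong (ℤ._+ + 1) ([+m]-[+n]≡+[m∸n] (ℕ.m≤m+n m n)) ⟨
  + (m + n) ℤ.- + m ℤ.+ + 1   ∎

module _ (a b : ℕ) (X Y : Str) where

  private
    V U : Str
    V = ch a ∷ X
    U = ch b ∷ Y

    κV κU : ℕ
    κV = conversions a (rot1 V)
    κU = conversions b (rot1 U)

    convV : Converts 0 κV (PD (rot1 V)) (pdGo [ ch a ] (rot1 V))
    convV = conversions-converts a (rot1 V)

    convU : Converts 0 κU (PD (rot1 U)) (pdGo [ ch b ] (rot1 U))
    convU = conversions-converts b (rot1 U)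

    agreement : κV ≡ κU → κV < lcpcount (rot1 V) (rot1 U) →
      lcpcount (rot1 V) (rot1 U) ≡ κV + lcpRank (pdGo [ ch a ] (rot1 V)) (pdGo [ ch b ] (rot1 U))
      × CommonPrefixReplaced (PD (rot1 V)) (PD (rot1 U)) (pdGo [ ch a ] (rot1 V)) (pdGo [ ch b ] (rot1 U))
    agreement κV≡κU =
      converts-agree convV (subst (λ j → Converts 0 j _ _) (sym κV≡κU) convU)

    π-≡-val : ∀ {z} → π V ≡ val z → π U ≡ val z → z ≡ + κV × κV ≡ κU
    π-≡-val {z} πV≡z πU≡z = sym +κV≡z , ℤ.+-injective (trans +κV≡z (sym +κU≡z))
      where
      +κV≡z : + κV ≡ z
      +κV≡z = val-injective (trans (sym (π-∷ a X)) πV≡z)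
      +κU≡z : + κU ≡ z
      +κU≡z = val-injective (trans (sym (π-∷ b Y)) πU≡z)

  lcpcount-∷-agree : ∀ z → π V ≡ val z → π U ≡ val z → z ℤ.< + lcpcount (rot1 V) (rot1 U) →
                     + lcpcount V U ≡ + lcpcount (rot1 V) (rot1 U) ℤ.- z ℤ.+ + 1
  lcpcount-∷-agree z πV≡z πU≡z z<e with refl , κV≡κU ← π-≡-val πV≡z πU≡z = begin
    + lcpcount V U                                           ≡⟨ cong +_ (lcpcount-∷ a b X Y) ⟩
    + suc L                                                  ≡⟨ +suc≡[+m+n]-[+m]+1 κV L ⟩
    + (κV + L) ℤ.- + κV ℤ.+ + 1                              ≡⟨ cong (λ e → + e ℤ.- + κV ℤ.+ + 1) e≡κV+L ⟨
    + lcpcount (rot1 V) (rot1 U) ℤ.- + κV ℤ.+ + 1            ∎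
    where
    L : ℕ
    L = lcpRank (pdGo [ ch a ] (rot1 V)) (pdGo [ ch b ] (rot1 U))
    e≡κV+L : lcpcount (rot1 V) (rot1 U) ≡ κV + L
    e≡κV+L = proj₁ (agreement κV≡κU (ℤ.drop‿+<+ z<e))

  lcpcount-∷-disagree : rot1 V ≺ω rot1 U →
    ¬ (V ≺ω U × (Σ ℤ λ z → (π V ≡ val z) × (π U ≡ val z) × (z ℤ.< + lcpcount (rot1 V) (rot1 U)))) →
    lcpcount V U ≡ 1
  lcpcount-∷-disagree rot≺ not-agreeing =
    trans (lcpcount-∷ a b X Y) (cong suc (converts-disagree convV convU differ))
    where
    differ : ¬ (κV ≡ κU × κV < lcpcount (rot1 V) (rot1 U))
    differ (κV≡κU , κV<e) = not-agreeing
      ( ≺ω-∷ (proj₂ (agreement κV≡κU κV<e)) rot≺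
      , + κV , π-∷ a X , trans (π-∷ b Y) (cong (val ∘ +_) (sym κV≡κU)) , +<+ κV<e)

lemma18 : (V U : Str) → V ≢ [] → U ≢ [] → rot1 V ≺ω rot1 U →
    ((π V ≡ $ ⊎ π U ≡ $) → lcpcount V U ≡ 0)
    × ((z : ℤ) → V ≺ω U → π V ≡ val z → π U ≡ val z → z ℤ.< + lcpcount (rot1 V) (rot1 U) →
        + lcpcount V U ≡ + lcpcount (rot1 V) (rot1 U) ℤ.- z ℤ.+ + 1)
    × (¬ (π V ≡ $ ⊎ π U ≡ $) →
       ¬ (V ≺ω U × (Σ ℤ λ z → (π V ≡ val z) × (π U ≡ val z) × (z ℤ.< + lcpcount (rot1 V) (rot1 U)))) →
       lcpcount V U ≡ 1)
lemma18 []      _  V≢[] _    _ = contradiction refl V≢[]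
lemma18 (_ ∷ _) [] _    U≢[] _ = contradiction refl U≢[]
lemma18 ($ ∷ X) U  _    _    _ =
  (λ _ → lcpcount-$∷ X U) , (λ _ _ ()) , λ no-$ _ → contradiction (inj₁ refl) no-$
lemma18 (ch a ∷ X) ($ ∷ Y) _ _ _ =
  (λ _ → refl) , (λ _ _ _ ()) , λ no-$ _ → contradiction (inj₂ refl) no-$
-- The hypothesis V ≺ω U of the second case follows from the others (see ≺ω-∷).
lemma18 (ch a ∷ X) (ch b ∷ Y) _ _ rot≺ =
  (λ { (inj₁ ()) ; (inj₂ ()) }) ,
  (λ z _ → lcpcount-∷-agree a b X Y z) ,
  λ _ → lcpcount-∷-disagree a b X Y rot≺
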